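{- Let $\mathcal{L}_1=(S_1,\iota_1,\rightarrow_1)$ and $\mathcal{L}_2=(S_2,\iota_2,\rightarrow_2)$ be LTSs and let $\mathcal{L}_1\ltimes\mathcal{L}_2=(S,\iota,\rightarrow)$ be their product. For all states $(s_1,s_2),(t_1,t_2)\in S$ and all sequences $\rho\in\mathit{Act}^*$: $(s_1,s_2)\overset{\rho}{\Longrightarrow}(t_1,t_2)$ in $\mathcal{L}_1\ltimes\mathcal{L}_2$ if and only if $s_1\overset{\rho}{\twoheadrightarrow}_1 t_1$ in $\mathcal{L}_1$ and $s_2\overset{\rho}{\Longrightarrow}_2 t_2$ in $\mathcal{L}_2$.
   Context: Fix a finite set $\mathit{Act}$ of actions not containing the internal action $\tau$; $\mathit{Act}_\tau=\mathit{Act}\cup\{\tau\}$. An LTS is a tuple $(S,\iota,\rightarrow)$ with a set of states $S$, initial state $\iota\in S$ and $\rightarrow\subseteq S\times\mathit{Act}_\tau\times S$; write $s\xrightarrow{a}t$. For $\sigma\in\mathit{Act}_\tau^*$, $s\overset{\sigma}{\twoheadrightarrow}t$ is defined by: $s\overset{\epsilon}{\twoheadrightarrow}t$ iff $s=t$, and $s\overset{\sigma a}{\twoheadrightarrow}t$ iff there is $u$ with $s\overset{\sigma}{\twoheadrightarrow}u$ and $u\xrightarrow{a}t$. The weak transition relation $\Longrightarrow\subseteq S\times\mathit{Act}^*\times S$ is the smallest relation such that $s\overset{\epsilon}{\Longrightarrow}s$; $s\overset{\epsilon}{\Longrightarrow}t$ if $s\xrightarrow{\tau}t$; $s\overset{a}{\Longrightarrow}t$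 if $s\xrightarrow{a}t$ for $a\in\mathit{Act}$; and $s\overset{\rho\sigma}{\Longrightarrow}t$ if $s\overset{\rho}{\Longrightarrow}u$ and $u\overset{\sigma}{\Longrightarrow}t$ for some $u$. The product $\mathcal{L}_1\ltimes\mathcal{L}_2$ is the LTS with states $S_1\times S_2$, initial state $(\iota_1,\iota_2)$, and the smallest transition relation such that for all $s_1,t_1\in S_1$, $s_2,t_2\in S_2$, $a\in\mathit{Act}$: if $s_2\xrightarrow{\tau}_2t_2$ then $(s_1,s_2)\xrightarrow{\tau}(s_1,t_2)$; if $s_1\xrightarrow{a}_1t_1$ and $s_2\xrightarrow{a}_2t_2$ then $(s_1,s_2)\xrightarrow{a}(t_1,t_2)$. -}

module Defs where

open import Level using (Level; _⊔_; suc)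
open import Data.Nat using (ℕ)
open import Data.Fin using (Fin)
open import Data.Maybe using (Maybe; just; nothing)
open import Data.List using (List; []; _∷_; _++_; map; [_])
open import Data.List using (_∷ʳ_)
open import Data.Product using (_×_; _,_; ∃)
open import Relation.Binary.PropositionalEquality using (_≡_)

-- The finite action set Act is represented as Fin n (any finite set is in
-- bijection with some Fin n).  Act_τ = Maybe Act, with nothing = τ.
module _ {n : ℕ} where
  Act : Set
  Act = Fin n

  Actτ : Set
  Actτ = Maybe Act

  τ : Actτ
  τ = nothing

  record LTS (ℓ : Level) : Set (suc ℓ) where
    field
      State : Set ℓ
      init  : State
      _─[_]→_ : State → Actτ → State → Set ℓ
  open LTS public

  data Steps {ℓ} (L : LTS ℓ) : State L → List Actτ → State L → Set ℓ where
    ε-steps : ∀ {s} → Steps L s [] s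
    snoc-step : ∀ {s σ a u t} → Steps L s σ u → (L ─[ u ]→ a) t →
                Steps L s (σ ∷ʳ a) t

  data Weak {ℓ} (L : LTS ℓ) : State L → List Act → State L → Set ℓ where
    w-refl : ∀ {s} → Weak L s [] s
    w-tau  : ∀ {s t} → (L ─[ s ]→ τ) t → Weak L s [] t
    w-act  : ∀ {s t} (a : Act) → (L ─[ s ]→ just a) t → Weak L s [ a ] t
    w-comp : ∀ {s u t ρ σ} → Weak L s ρ u → Weak L u σ t → Weak L s (ρ ++ σ) t

  data ProdStep {ℓ₁ ℓ₂} (L₁ : LTS ℓ₁) (L₂ : LTS ℓ₂) :
       State L₁ × State L₂ → Actτ → State L₁ × State L₂ → Set (ℓ₁ ⊔ ℓ₂) where
    tau-right : ∀ {s₁ s₂ t₂} → (L₂ ─[ s₂ ]→ τ) t₂ →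
                ProdStep L₁ L₂ (s₁ , s₂) τ (s₁ , t₂)
    sync : ∀ {s₁ t₁ s₂ t₂} (a : Act) → (L₁ ─[ s₁ ]→ just a) t₁ →
           (L₂ ─[ s₂ ]→ just a) t₂ → ProdStep L₁ L₂ (s₁ , s₂) (just a) (t₁ , t₂)

  _⋉_ : ∀ {ℓ₁ ℓ₂} → LTS ℓ₁ → LTS ℓ₂ → LTS (ℓ₁ ⊔ ℓ₂)
  L₁ ⋉ L₂ = record
    { State = State L₁ × State L₂
    ; init = (init L₁ , init L₂)
    ; _─[_]→_ = ProdStep L₁ L₂ }

module Submission where

-- Steps is defined by adding transitions at the END of a sequence, but both
-- directions of the proof recurse on how a weak transition is composed, so
-- they need the sequence split at the FRONT.
--
-- The theorem then follows by induction on weak derivations.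
--  (⇒) Each product step is τ on the right or a synchronised visible action,
--      and L₁ never moves on τ.  So a product weak transition projects to an
--      L₁ path labelled by the visible actions and an L₂ weak transition.
--  (⇐) Recurse on the L₂ weak transition, splitting the L₁ path at the same
--      place; base cases pair up as single product steps.

open import Defs
open import Level using (Level)
open import Data.Nat using (ℕ)
open import Data.Fin using (Fin)
open import Data.Maybe using (just)
open import Data.List using (List; []; _∷_; _++_; _∷ʳ_; map)
open import Data.List.Properties using (map-++)
open import Data.Product using (_×_; _,_; proj₁; proj₂; ∃)
open import Function.Bundles using (_⇔_; mk⇔)
open import Relation.Binary.PropositionalEquality using (subst; sym)

module Paths {n : ℕ} {ℓ : Level} (L : LTS {n} ℓ) where

  data Path : State L → List (Actτ {n}) → State L → Set ℓ where
    done : ∀ {s} → Path s [] s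
    step : ∀ {s a u σ t} → (L ─[ s ]→ a) u → Path u σ t → Path s (a ∷ σ) t

  _▸_ : ∀ {s σ u a t} → Path s σ u → (L ─[ u ]→ a) t → Path s (σ ∷ʳ a) t
  done     ▸ x = step x done
  step y p ▸ x = step y (p ▸ x)

  _◂_ : ∀ {s a u σ t} → (L ─[ s ]→ a) u → Steps L u σ t → Steps L s (a ∷ σ) t
  x ◂ ε-steps       = snoc-step ε-steps x
  x ◂ snoc-step p y = snoc-step (x ◂ p) y

  steps⇒path : ∀ {s σ t} → Steps L s σ t → Path s σ t
  steps⇒path ε-steps         = done
  steps⇒path (snoc-step p x) = steps⇒path p ▸ x

  path⇒steps : ∀ {s σ t} → Path s σ t → Steps L s σ t
  path⇒steps done       = ε-steps
  path⇒steps (step x p) = x ◂ path⇒steps p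

  _++ᴾ_ : ∀ {s σ u σ′ t} → Path s σ u → Path u σ′ t → Path s (σ ++ σ′) t
  done     ++ᴾ q = q
  step x p ++ᴾ q = step x (p ++ᴾ q)

  split : ∀ {s t} σ {σ′} → Path s (σ ++ σ′) t → ∃ λ u → Path s σ u × Path u σ′ t
  split []      p          = _ , done , p
  split (a ∷ σ) (step x p) with split σ p
  ... | u , q , r = u , step x q , r

module Product {n : ℕ} {ℓ₁ ℓ₂ : Level} (L₁ : LTS {n} ℓ₁) (L₂ : LTS {n} ℓ₂) where
  open Paths L₁

  unmap-++ : ∀ {s t} (ρ σ : List (Fin n)) →
             Path s (map just ρ ++ map just σ) t → Path s (map just (ρ ++ σ)) t
  unmap-++ ρ σ = subst (λ l → Path _ l _) (sym (map-++ just ρ σ))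

  remap-++ : ∀ {s t} (ρ σ : List (Fin n)) →
             Path s (map just (ρ ++ σ)) t → Path s (map just ρ ++ map just σ) t
  remap-++ ρ σ = subst (λ l → Path _ l _) (map-++ just ρ σ)

  project : ∀ {p q} {ρ : List (Fin n)} → Weak (L₁ ⋉ L₂) p ρ q →
            Path (proj₁ p) (map just ρ) (proj₁ q) × Weak L₂ (proj₂ p) ρ (proj₂ q)
  project w-refl                  = done , w-refl
  project (w-tau (tau-right y))   = done , w-tau y
  project (w-act a (sync .a x y)) = step x done , w-act a y
  project (w-comp {ρ = ρ} {σ = σ} w v) with project w | project v
  ... | p₁ , w₂ | q₁ , v₂ = unmap-++ ρ σ (p₁ ++ᴾ q₁) , w-comp w₂ v₂

  combine : ∀ {s₁ t₁ s₂ t₂} {ρ : List (Fin n)} → Weak L₂ s₂ ρ t₂ →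
            Path s₁ (map just ρ) t₁ → Weak (L₁ ⋉ L₂) (s₁ , s₂) ρ (t₁ , t₂)
  combine w-refl      done          = w-refl
  combine (w-tau y)   done          = w-tau (tau-right y)
  combine (w-act a y) (step x done) = w-act a (sync a x y)
  combine (w-comp {ρ = ρ} {σ = σ} w v) p with split (map just ρ) (remap-++ ρ σ p)
  ... | _ , p₁ , p₂ = w-comp (combine w p₁) (combine v p₂)

proposition3p2 : ∀ {n : ℕ} {ℓ₁ ℓ₂ : Level} (L₁ : LTS {n} ℓ₁) (L₂ : LTS {n} ℓ₂)
    (s₁ t₁ : State L₁) (s₂ t₂ : State L₂) (ρ : List (Fin n)) →
    Weak (L₁ ⋉ L₂) (s₁ , s₂) ρ (t₁ , t₂)
      ⇔ (Steps L₁ s₁ (map just ρ) t₁ × Weak L₂ s₂ ρ t₂)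
proposition3p2 L₁ L₂ s₁ t₁ s₂ t₂ ρ = mk⇔ forward backward
  where
    open Paths L₁ using (steps⇒path; path⇒steps)
    open Product L₁ L₂ using (project; combine)

    forward : Weak (L₁ ⋉ L₂) (s₁ , s₂) ρ (t₁ , t₂) →
              Steps L₁ s₁ (map just ρ) t₁ × Weak L₂ s₂ ρ t₂
    forward w with project w
    ... | p₁ , w₂ = path⇒steps p₁ , w₂

    backward : Steps L₁ s₁ (map just ρ) t₁ × Weak L₂ s₂ ρ t₂ →
               Weak (L₁ ⋉ L₂) (s₁ , s₂) ρ (t₁ , t₂)
    backward (p₁ , w₂) = combine w₂ (steps⇒path p₁)
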